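{- Let $\mathcal A$ be a first-order structure and $x_0\in U_{\mathcal A}$. If $\{x_0\}$ (a set of one 1-tuple) is semi-decidable by a BSS RAM in $\mathsf M_{\mathcal A}$, then its complement $U_{\mathcal A}^\infty\setminus\{x_0\}$ is semi-decidable by a BSS RAM in $\mathsf M_{\mathcal A}$, and thus $\{x_0\}\in{\rm DEC}_{\mathcal A}$.
   Context: A first-order structure $\mathcal A=(U_{\mathcal A};(c_i)_{i\in N_1};(f_i)_{i\in N_2};(r_i)_{i\in N_3})$ of finite signature consists of a universe, constants, operations and relations. $U_{\mathcal A}^\infty=\bigcup_{n\ge 1}U_{\mathcal A}^n$. A (deterministic) BSS RAM over $\mathcal A$ (class $\mathsf M_{\mathcal A}$) has registers $Z_1,Z_2,\dots$ for elements of $U_{\mathcal A}$, finitely many index registers $I_1,\dots,I_k$ for positive integers, and a finite program of labeled instructions ending with stop; instructions: $Z_j:=f_i(Z_{j_1},\dots,Z_{j_m})$, $Z_j:=c_i$, $Z_j:=Z_k$, $Z_{I_j}:=Z_{I_k}$, $I_j:=1$, $I_j:=I_j+1$, "if $r_i(Z_{j_1},\dots,Z_{j_k})$ then goto $\ell_1$ else goto $\ell_2$", "if $I_j=I_k$ then goto $\ell_1$ else goto $\ell_2$", stop, using only the constants, operations and relations of $\mathcal A$ (equality of elements of $U_{\mathcal A}$ can be tested directly only if the identity is a relation of $\mathcal A$). On input $(x_1,\dots,x_n)$: start at label 1 with $Z_i=x_i$ ($i\le n$), $Z_i=x_n$ ($i>n$), $I_1=n$, other index registers $1$. A set $P\subseteq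 U_{\mathcal A}^\infty$ is semi-decidable by $\mathcal M$ if $P$ is exactly the set of inputs on which $\mathcal M$ reaches stop; ${\rm SDEC}_{\mathcal A}$ is the class of such sets and ${\rm DEC}_{\mathcal A}$ the class of $P$ with $P$ and $U_{\mathcal A}^\infty\setminus P$ in ${\rm SDEC}_{\mathcal A}$. -}

module Defs where

open import Data.Nat using (ℕ; zero; suc; _≡ᵇ_; _<_; _≤?_; _<?_)
open import Data.Fin using (Fin; zero; suc; toℕ; fromℕ; fromℕ<)
open import Data.Vec using (Vec; []; _∷_; lookup; map; last)
open import Data.Bool using (Bool; true; false; if_then_else_)
open import Data.Product using (Σ; Σ-syntax; _×_; _,_; ∃; proj₁; proj₂)
open import Relation.Binary.PropositionalEquality using (_≡_)
open import Relation.Nullary using (¬_; yes; no)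
open import Data.Nat.Properties using (≤-refl)

record Structure : Set₁ where
  field
    U      : Set
    nc     : ℕ
    cst    : Fin nc → U
    nf     : ℕ
    farity : Fin nf → ℕ
    opr    : (i : Fin nf) → Vec U (farity i) → U
    nr     : ℕ
    rarity : Fin nr → ℕ
    rel    : (i : Fin nr) → Vec U (rarity i) → Bool

open Structure public

-- U^∞ = ⋃_{n ≥ 1} U^n : a tuple of length (suc n).
Input : Structure → Set
Input A = Σ[ n ∈ ℕ ] Vec (U A) (suc n)

-- Conventions (0-based internally):
--   * a register index j : ℕ in an instruction denotes Z_{j+1};
--   * the contents of an index register, v : ℕ, denotes the positive
--     integer v+1, so register Z_{I} is stored at position v;
--   * there are k = suc k' index registers I_1 … I_k (Fin (suc k'));
--   * labels 1 … L are Fin L, label 1 is zero.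

data Instr (A : Structure) (k L : ℕ) : Set where
  opI    : (j : ℕ) (i : Fin (nf A)) → Vec ℕ (farity A i) → Instr A k L
  cstI   : (j : ℕ) (i : Fin (nc A)) → Instr A k L
  copyI  : (j l : ℕ) → Instr A k L
  icopyI : (j l : Fin k) → Instr A k L
  isetI  : (j : Fin k) → Instr A k L
  iincI  : (j : Fin k) → Instr A k L
  relI   : (i : Fin (nr A)) → Vec ℕ (rarity A i) → (l₁ l₂ : Fin L) → Instr A k L
  ieqI   : (j l : Fin k) → (l₁ l₂ : Fin L) → Instr A k L
  stopI  : Instr A k L

record Machine (A : Structure) : Set where
  field
    k'       : ℕ
    m        : ℕ
    code     : Fin (suc m) → Instr A (suc k') (suc m)
    lastStop : code (fromℕ m) ≡ stopI

open Machine public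

record Config (A : Structure) (M : Machine A) : Set where
  constructor ⟨_,_,_⟩
  field
    label : Fin (suc (m M))
    Z     : ℕ → U A
    I     : Fin (suc (k' M)) → ℕ

open Config public

-- next label l+1 (the fallback is unreachable: the last instruction is stop)
nextLabel : {n : ℕ} → Fin (suc n) → Fin (suc n)
nextLabel {n} l with suc (toℕ l) <? suc n
... | yes p = fromℕ< p
... | no _  = l

updZ : {X : Set} → (ℕ → X) → ℕ → X → (ℕ → X)
updZ Z j v p = if p ≡ᵇ j then v else Z p

updI : {k : ℕ} → (Fin k → ℕ) → Fin k → ℕ → (Fin k → ℕ)
updI I j v p = if toℕ p ≡ᵇ toℕ j then v else I p

step : {A : Structure} {M : Machine A} → Config A M → Config A M
step {A} {M} c with code M (label c)
... | opI j i js     = ⟨ nextLabel (label c) , updZ (Z c) j (opr A i (map (Z c) js)) , I c ⟩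
... | cstI j i       = ⟨ nextLabel (label c) , updZ (Z c) j (cst A i) , I c ⟩
... | copyI j l      = ⟨ nextLabel (label c) , updZ (Z c) j (Z c l) , I c ⟩
... | icopyI j l     = ⟨ nextLabel (label c) , updZ (Z c) (I c j) (Z c (I c l)) , I c ⟩
... | isetI j        = ⟨ nextLabel (label c) , Z c , updI (I c) j 0 ⟩
... | iincI j        = ⟨ nextLabel (label c) , Z c , updI (I c) j (suc (I c j)) ⟩
... | relI i js l₁ l₂ = ⟨ (if rel A i (map (Z c) js) then l₁ else l₂) , Z c , I c ⟩
... | ieqI j l l₁ l₂  = ⟨ (if I c j ≡ᵇ I c l then l₁ else l₂) , Z c , I c ⟩
... | stopI          = c

iterate : {X : Set} → (X → X) → ℕ → X → X
iterate f zero x = x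
iterate f (suc t) x = f (iterate f t x)

initZ : {X : Set} {n : ℕ} → Vec X (suc n) → ℕ → X
initZ {n = n} xs p with p <? suc n
... | yes q = lookup xs (fromℕ< q)
... | no _  = last xs

-- Start: label 1, I_1 = length (stored as n since length = suc n), others 1.
initConfig : {A : Structure} (M : Machine A) → Input A → Config A M
initConfig M (n , xs) = ⟨ zero , initZ xs , (λ { zero → n ; (suc _) → 0 }) ⟩

Halts : {A : Structure} (M : Machine A) → Input A → Set
Halts M x = ∃ λ t → code M (label (iterate step t (initConfig M x))) ≡ stopI

SemiDecides : {A : Structure} → Machine A → (Input A → Set) → Set
SemiDecides M P = ∀ x → (P x → Halts M x) × (Halts M x → P x)

SDEC : (A : Structure) → (Input A → Set) → Set
SDEC A P = Σ[ M ∈ Machine A ] SemiDecides M P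

DEC : (A : Structure) → (Input A → Set) → Set
DEC A P = SDEC A P × SDEC A (λ x → ¬ P x)

Singleton : (A : Structure) → U A → Input A → Set
Singleton A x0 x = x ≡ (0 , x0 ∷ [])

{-# OPTIONS --safe #-}
-- M halts on x₀ after some t steps, so its computation on x₀ is a fixed path
-- of t instructions together with the outcomes of their tests.  The machine M'
-- halts at once on inputs of length ≠ 1; on a 1-tuple y it replays that path
-- on y, halting as soon as a test on y comes out differently than on x₀ (so
-- y ≠ x₀), and loops forever once all t tests agreed.  In the latter case M's
-- computation on y followed the one on x₀ and stopped, so y = x₀ because M
-- semi-decides {x₀}.
module Submission where

open import Defs
open import Data.Product using (_×_)
open import Relation.Nullary using (¬_)

open import Relation.Nullary using (yes; no)
open import Data.Bool using (Bool; true; false; if_then_else_)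
open import Data.Bool.Properties using (if-eta)
open import Data.Empty using (⊥-elim)
open import Data.Fin using (Fin; zero; suc; toℕ; fromℕ; fromℕ<; inject₁)
open import Data.Fin.Properties using (toℕ-fromℕ; toℕ-fromℕ<; toℕ-inject₁; toℕ-injective)
open import Data.Nat using (ℕ; zero; suc; _≤_; _<_; _⊓_; _≡ᵇ_; _<?_; _≤?_; s≤s)
open import Data.Nat.Properties
  using (<-cmp; <-irrefl; <-asym; n<1+n; n≤1+n; <⇒≤; ≤-refl; ≰⇒>; m≤n⇒m≤1+n; m≤n⇒m<n∨m≡n; m≤n⇒m⊓n≡m; m≥n⇒m⊓n≡n; m⊓n≤n)
open import Data.Product using (_,_; proj₁; proj₂)
open import Data.Sum using (_⊎_; inj₁; inj₂; [_,_]′)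
open import Data.Vec using ([]; _∷_; map)
open import Data.Vec.Properties using (map-cong)
open import Function using (_∘_; id)
open import Relation.Binary.Definitions using (tri<; tri≈; tri>)
open import Relation.Binary.PropositionalEquality
  using (_≡_; _≢_; _≗_; refl; sym; trans; cong; cong₂; subst)

updZ-cong : {X : Set} {Z′ Z : ℕ → X} {a′ a : ℕ} {v′ v : X} →
  Z′ ≗ Z → a′ ≡ a → v′ ≡ v → updZ Z′ a′ v′ ≗ updZ Z a v
updZ-cong {a = a} Z′≗Z refl refl p with p ≡ᵇ a
... | true  = refl
... | false = Z′≗Z p

updI-inject₁ : {k : ℕ} {I′ : Fin (suc k) → ℕ} {I : Fin k → ℕ} (j : Fin k) {v′ v : ℕ} →
  I′ ∘ inject₁ ≗ I → v′ ≡ v → updI I′ (inject₁ j) v′ ∘ inject₁ ≗ updI I j v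
updI-inject₁ j I′≗I refl q rewrite toℕ-inject₁ q | toℕ-inject₁ j with toℕ q ≡ᵇ toℕ j
... | true  = refl
... | false = I′≗I q

toℕ-nextLabel : {n : ℕ} (l : Fin (suc n)) → suc (toℕ l) < suc n → toℕ (nextLabel l) ≡ suc (toℕ l)
toℕ-nextLabel {n} l in-range with suc (toℕ l) <? suc n
... | yes p = toℕ-fromℕ< p
... | no ¬p = ⊥-elim (¬p in-range)

run : {A : Structure} (M : Machine A) → U A → ℕ → Config A M
run M y s = iterate step s (initConfig M (0 , y ∷ []))

module _ {A : Structure} {M : Machine A} where

  execute : Instr A (suc (k' M)) (suc (m M)) → Config A M → Config A M
  execute (opI j i js)       c = ⟨ nextLabel (label c) , updZ (Z c) j (opr A i (map (Z c) js)) , I c ⟩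
  execute (cstI j i)         c = ⟨ nextLabel (label c) , updZ (Z c) j (cst A i) , I c ⟩
  execute (copyI j l)        c = ⟨ nextLabel (label c) , updZ (Z c) j (Z c l) , I c ⟩
  execute (icopyI j l)       c = ⟨ nextLabel (label c) , updZ (Z c) (I c j) (Z c (I c l)) , I c ⟩
  execute (isetI j)          c = ⟨ nextLabel (label c) , Z c , updI (I c) j 0 ⟩
  execute (iincI j)          c = ⟨ nextLabel (label c) , Z c , updI (I c) j (suc (I c j)) ⟩
  execute (relI i js l₁ l₂)  c = ⟨ (if rel A i (map (Z c) js) then l₁ else l₂) , Z c , I c ⟩
  execute (ieqI j l l₁ l₂)   c = ⟨ (if I c j ≡ᵇ I c l then l₁ else l₂) , Z c , I c ⟩
  execute stopI              c = c

  step≡execute : (c : Config A M) → step c ≡ execute (code M (label c)) c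
  step≡execute c with code M (label c)
  ... | opI _ _ _      = refl
  ... | cstI _ _       = refl
  ... | copyI _ _      = refl
  ... | icopyI _ _     = refl
  ... | isetI _        = refl
  ... | iincI _        = refl
  ... | relI _ _ _ _   = refl
  ... | ieqI _ _ _ _   = refl
  ... | stopI          = refl

  step-at : {ins : Instr A (suc (k' M)) (suc (m M))} (c : Config A M) →
    code M (label c) ≡ ins → step c ≡ execute ins c
  step-at c refl = step≡execute c

module TraceMachine {A : Structure} (M : Machine A) (x0 : U A) (t : ℕ) where

  K L : ℕ
  K = suc (suc (k' M))
  L = suc (suc (suc t))

  exit : Fin L
  exit = fromℕ (suc (suc t))

  lab : ℕ → Fin L
  lab n with n <? L
  ... | yes p = fromℕ< p
  ... | no _  = exit

  toℕ-lab : (n : ℕ) → n < L → toℕ (lab n) ≡ n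
  toℕ-lab n in-range with n <? L
  ... | yes p = toℕ-fromℕ< p
  ... | no ¬p = ⊥-elim (¬p in-range)

  -- ins as executed at the trace configuration d: a test continues to next if
  -- its outcome agrees with the one at d, and jumps to exit otherwise.
  guard : Instr A (suc (k' M)) (suc (m M)) → Config A M → Fin L → Instr A K L
  guard (opI j i js)      d next = opI j i js
  guard (cstI j i)        d next = cstI j i
  guard (copyI j l)       d next = copyI j l
  guard (icopyI j l)      d next = icopyI (inject₁ j) (inject₁ l)
  guard (isetI j)         d next = isetI (inject₁ j)
  guard (iincI j)         d next = iincI (inject₁ j)
  guard (relI i js _ _)   d next = let b = rel A i (map (Z d) js) in
    relI i js (if b then next else exit) (if b then exit else next)
  guard (ieqI j l _ _)    d next = let b = I d j ≡ᵇ I d l in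
    ieqI (inject₁ j) (inject₁ l) (if b then next else exit) (if b then exit else next)
  guard stopI             d next = ieqI zero zero next next

  guard≢stopI : (ins : Instr A (suc (k' M)) (suc (m M))) (d : Config A M) (next : Fin L) →
    guard ins d next ≢ stopI
  guard≢stopI (opI _ _ _)    _ _ ()
  guard≢stopI (cstI _ _)     _ _ ()
  guard≢stopI (copyI _ _)    _ _ ()
  guard≢stopI (icopyI _ _)   _ _ ()
  guard≢stopI (isetI _)      _ _ ()
  guard≢stopI (iincI _)      _ _ ()
  guard≢stopI (relI _ _ _ _) _ _ ()
  guard≢stopI (ieqI _ _ _ _) _ _ ()
  guard≢stopI stopI          _ _ ()

  -- I₁ holds the input length, the fresh register I_K still holds 1.
  lengthTest : Instr A K L
  lengthTest = ieqI zero (fromℕ (suc (k' M))) (suc zero) exit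

  loop : Instr A K L
  loop = ieqI zero zero (lab (suc t)) (lab (suc t))

  traceStep : ℕ → Instr A K L
  traceStep s = guard (code M (label (run M x0 s))) (run M x0 s) (lab (suc (suc s)))

  body : ℕ → Instr A K L
  body zero = lengthTest
  body (suc s) with <-cmp s t
  ... | tri< _ _ _ = traceStep s
  ... | tri≈ _ _ _ = loop
  ... | tri> _ _ _ = stopI

  body-trace : {s : ℕ} → s < t → body (suc s) ≡ traceStep s
  body-trace {s} s<t with <-cmp s t
  ... | tri< _ _ _    = refl
  ... | tri≈ ¬s<t _ _ = ⊥-elim (¬s<t s<t)
  ... | tri> ¬s<t _ _ = ⊥-elim (¬s<t s<t)

  body-loop : body (suc t) ≡ loop
  body-loop with <-cmp t t
  ... | tri< t<t _ _ = ⊥-elim (<-irrefl refl t<t)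
  ... | tri≈ _ _ _   = refl
  ... | tri> _ _ t>t = ⊥-elim (<-irrefl refl t>t)

  body-exit : body (suc (suc t)) ≡ stopI
  body-exit with <-cmp (suc t) t
  ... | tri< t+1<t _ _ = ⊥-elim (<-asym t+1<t (n<1+n t))
  ... | tri≈ _ t+1≡t _ = ⊥-elim (<-irrefl (sym t+1≡t) (n<1+n t))
  ... | tri> _ _ _     = refl

  body≢stopI : {n : ℕ} → n ≤ suc t → body n ≢ stopI
  body≢stopI {zero} _ ()
  body≢stopI {suc s} (s≤s s≤t) with m≤n⇒m<n∨m≡n s≤t
  ... | inj₁ s<t  = guard≢stopI _ _ _ ∘ trans (sym (body-trace s<t))
  ... | inj₂ refl = (λ ()) ∘ trans (sym body-loop)

  M' : Machine A
  M' = record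
    { k'       = suc (k' M)
    ; m        = suc (suc t)
    ; code     = body ∘ toℕ
    ; lastStop = trans (cong body (toℕ-fromℕ (suc (suc t)))) body-exit
    }

  Agrees : Config A M' → Config A M → Set
  Agrees c′ c = Z c′ ≗ Z c × I c′ ∘ inject₁ ≗ I c

  guard-agrees : (ins : Instr A (suc (k' M)) (suc (m M))) {c′ : Config A M'} {c : Config A M}
    (d : Config A M) (next : Fin L) →
    Agrees c′ c → Agrees (execute (guard ins d next) c′) (execute ins c)
  guard-agrees (opI j i js)      d next (Z≗ , I≗) = updZ-cong Z≗ refl (cong (opr A i) (map-cong Z≗ js)) , I≗
  guard-agrees (cstI j i)        d next (Z≗ , I≗) = updZ-cong Z≗ refl refl , I≗
  guard-agrees (copyI j l)       d next (Z≗ , I≗) = updZ-cong Z≗ refl (Z≗ l) , I≗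
  guard-agrees (icopyI j l) {c′} {c} d next (Z≗ , I≗) =
    updZ-cong Z≗ (I≗ j) (trans (cong (Z c′) (I≗ l)) (Z≗ (I c l))) , I≗
  guard-agrees (isetI j) {c′}    d next (Z≗ , I≗) = Z≗ , updI-inject₁ {I′ = I c′} j I≗ refl
  guard-agrees (iincI j) {c′}    d next (Z≗ , I≗) = Z≗ , updI-inject₁ {I′ = I c′} j I≗ (cong suc (I≗ j))
  guard-agrees (relI _ _ _ _)    d next agrees = agrees
  guard-agrees (ieqI _ _ _ _)    d next agrees = agrees
  guard-agrees stopI             d next agrees = agrees

  module _ {c d : Config A M} {next : Fin L} where

    branch : {a′ a b : Bool} {X : Set} {l₁ l₂ : X} → a′ ≡ a → (c ≡ d → a ≡ b) →
      ((if a′ then (if b then next else exit) else (if b then exit else next)) ≡ next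
        × (if a then l₁ else l₂) ≡ (if b then l₁ else l₂))
      ⊎ ((if a′ then (if b then next else exit) else (if b then exit else next)) ≡ exit × c ≢ d)
    branch {true}  {b = true}  refl _    = inj₁ (refl , refl)
    branch {false} {b = false} refl _    = inj₁ (refl , refl)
    branch {true}  {b = false} refl same = inj₂ (refl , (λ ()) ∘ same)
    branch {false} {b = true}  refl same = inj₂ (refl , (λ ()) ∘ same)

    guard-label : (ins : Instr A (suc (k' M)) (suc (m M))) {c′ : Config A M'} →
      Agrees c′ c → nextLabel (label c′) ≡ next → label c ≡ label d →
      let c′⁺ = execute (guard ins d next) c′ in
      (label c′⁺ ≡ next × label (execute ins c) ≡ label (execute ins d))
      ⊎ (label c′⁺ ≡ exit × c ≢ d)
    guard-label (opI _ _ _)       _ at-next on-trace = inj₁ (at-next , cong nextLabel on-trace)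
    guard-label (cstI _ _)        _ at-next on-trace = inj₁ (at-next , cong nextLabel on-trace)
    guard-label (copyI _ _)       _ at-next on-trace = inj₁ (at-next , cong nextLabel on-trace)
    guard-label (icopyI _ _)      _ at-next on-trace = inj₁ (at-next , cong nextLabel on-trace)
    guard-label (isetI _)         _ at-next on-trace = inj₁ (at-next , cong nextLabel on-trace)
    guard-label (iincI _)         _ at-next on-trace = inj₁ (at-next , cong nextLabel on-trace)
    guard-label (relI i js _ _)   (Z≗ , _) _ _ =
      branch (cong (rel A i) (map-cong Z≗ js)) (cong λ e → rel A i (map (Z e) js))
    guard-label (ieqI j l _ _)    (_ , I≗) _ _ =
      branch (cong₂ _≡ᵇ_ (I≗ j) (I≗ l)) (cong λ e → I e j ≡ᵇ I e l)
    guard-label stopI             _ _ on-trace = inj₁ (if-eta _ , on-trace)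

  step-follows : (c′ : Config A M') (c d : Config A M) {next : Fin L} →
    code M' (label c′) ≡ guard (code M (label d)) d next →
    Agrees c′ c → nextLabel (label c′) ≡ next → label c ≡ label d →
    Agrees (step c′) (step c)
    × ((label (step c′) ≡ next × label (step c) ≡ label (step d)) ⊎ (label (step c′) ≡ exit × c ≢ d))
  step-follows c′ c d {next} at-guard agrees at-next on-trace
    rewrite step-at c′ at-guard | step-at c (cong (code M) on-trace) | step≡execute d =
    guard-agrees (code M (label d)) d next agrees , guard-label (code M (label d)) agrees at-next on-trace

  Deviates : U A → Set
  Deviates y = Halts M' (0 , y ∷ []) × y ≢ x0

  Follows : U A → ℕ → Set
  Follows y s = Agrees (run M' y (suc s)) (run M y s)
              × toℕ (label (run M' y (suc s))) ≡ suc s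
              × label (run M y s) ≡ label (run M x0 s)

  follows-start : (y : U A) → Follows y 0
  follows-start y = ((λ _ → refl) , λ { zero → refl ; (suc _) → refl }) , refl , refl

  next-in-range : {s : ℕ} → s < t → suc (suc s) < L
  next-in-range s<t = s≤s (s≤s (s≤s (<⇒≤ s<t)))

  follow-step : {y : U A} {s : ℕ} → s < t → Follows y s → Deviates y ⊎ Follows y (suc s)
  follow-step {y} {s} s<t (agrees , position , on-trace)
    with step-follows (run M' y (suc s)) (run M y s) (run M x0 s)
           (trans (cong body position) (body-trace s<t)) agrees at-next on-trace
    where
    at-next : nextLabel (label (run M' y (suc s))) ≡ lab (suc (suc s))
    at-next = toℕ-injective (trans (toℕ-nextLabel _ (subst (λ n → suc n < L) (sym position) (next-in-range s<t)))
                                   (trans (cong suc position) (sym (toℕ-lab _ (next-in-range s<t)))))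
  ... | agrees′ , inj₁ (at-next′ , on-trace′) =
    inj₂ (agrees′ , trans (cong toℕ at-next′) (toℕ-lab _ (next-in-range s<t)) , on-trace′)
  ... | _ , inj₂ (at-exit , off-trace) =
    inj₁ ((suc (suc s) , trans (cong (code M') at-exit) (lastStop M')) , off-trace ∘ cong (λ z → run M z s))

  deviates-or-follows : (y : U A) {s : ℕ} → s ≤ t → Deviates y ⊎ Follows y s
  deviates-or-follows y {zero}  _   = inj₂ (follows-start y)
  deviates-or-follows y {suc s} s<t = [ inj₁ , follow-step s<t ]′ (deviates-or-follows y (<⇒≤ s<t))

  x0-follows : {s : ℕ} → s ≤ t → Follows x0 s
  x0-follows s≤t = [ (λ deviates → ⊥-elim (proj₂ deviates refl)) , id ]′ (deviates-or-follows x0 s≤t)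

  loop-stays : (c′ : Config A M') → toℕ (label c′) ≡ suc t → toℕ (label (step c′)) ≡ suc t
  loop-stays c′ at-loop
    rewrite step-at c′ (trans (cong body at-loop) body-loop) | if-eta (I c′ zero ≡ᵇ I c′ zero) {lab (suc t)} =
    toℕ-lab (suc t) (s≤s (s≤s (n≤1+n t)))

  toℕ-label-x0 : (T : ℕ) → toℕ (label (run M' x0 T)) ≡ T ⊓ suc t
  toℕ-label-x0 zero = refl
  toℕ-label-x0 (suc s) with s ≤? t
  ... | yes s≤t = trans (proj₁ (proj₂ (x0-follows s≤t))) (sym (m≤n⇒m⊓n≡m (s≤s s≤t)))
  ... | no s≰t  = trans (loop-stays _ (trans (toℕ-label-x0 s) (m≥n⇒m⊓n≡n t<s)))
                        (sym (m≥n⇒m⊓n≡n (m≤n⇒m≤1+n t<s)))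
    where
    t<s : suc t ≤ s
    t<s = ≰⇒> s≰t

  never-halts-on-x0 : ¬ Halts M' (0 , x0 ∷ [])
  never-halts-on-x0 (T , halts) =
    body≢stopI (subst (_≤ suc t) (sym (toℕ-label-x0 T)) (m⊓n≤n T (suc t))) halts

  semiDecides-complement : code M (label (run M x0 t)) ≡ stopI →
    (∀ x → Halts M x → Singleton A x0 x) → SemiDecides M' (λ x → ¬ Singleton A x0 x)
  semiDecides-complement halts-at-t sound x =
    halts-off x , λ halts x≡x0 → never-halts-on-x0 (subst (Halts M') x≡x0 halts)
    where
    halts-off : ∀ x → ¬ Singleton A x0 x → Halts M' x
    halts-off (suc _ , _) _ = 1 , lastStop M'
    halts-off (zero , y ∷ []) y∉ with deviates-or-follows y ≤-refl
    ... | inj₁ (halts , _)          = halts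
    ... | inj₂ (_ , _ , on-trace)   = ⊥-elim (y∉ (sound _ (t , trans (cong (code M) on-trace) halts-at-t)))

proposition6p11 : (A : Structure) (x0 : U A) →
    SDEC A (Singleton A x0) →
    SDEC A (λ x → ¬ Singleton A x0 x) × DEC A (Singleton A x0)
proposition6p11 A x0 (M , semidecides) = complement , (M , semidecides) , complement
  where
  halts-on-x0 : Halts M (0 , x0 ∷ [])
  halts-on-x0 = proj₁ (semidecides _) refl
  open TraceMachine M x0 (proj₁ halts-on-x0)
  complement : SDEC A (λ x → ¬ Singleton A x0 x)
  complement = M' , semiDecides-complement (proj₂ halts-on-x0) (proj₂ ∘ semidecides)
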